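{- Let $J$ be a finite index set and $\varphi_j$ an fPIL formula over $P$ and a De Morgan algebra $K$ for every $j\in J$. Then $\bigotimes_{j\in J}(\sim\varphi_j)\equiv\,\sim\biguplus_{j\in J}\varphi_j$.
   Context: A De Morgan algebra $(K,\vee,\wedge,0,1,\overline{\cdot})$ is a bounded distributive lattice with bottom $0$, top $1$ and a map $k\mapsto\overline k$ with $\overline{\overline k}=k$ and the De Morgan laws. $P$ is a set of ports; a $K$-fuzzy interaction is $\alpha:P\to K$ with $\alpha(p)\ne0$ for some $p$; $fC(P,K)$ is the set of nonempty (finite) sets of $K$-fuzzy interactions. fPIL formulas: $\varphi::=true\mid p\mid\,!\varphi\mid\varphi\sqcup\varphi$ with $\|true\|(\alpha)=1$, $\|p\|(\alpha)=\alpha(p)$, $\|!\varphi\|(\alpha)=\overline{\|\varphi\|(\alpha)}$, $\|\varphi_1\sqcup\varphi_2\|(\alpha)=\|\varphi_1\|(\alpha)\vee\|\varphi_2\|(\alpha)$. fPCL formulas: $\zeta::=\varphi\mid\neg\zeta\mid\zeta\oplus\zeta\mid\zeta\uplus\zeta$, $\zeta\otimes\zeta':=\neg(\neg\zeta\oplus\neg\zeta')$, $\sim\zeta:=\zeta\uplus true$; for $\gamma\in fC(P,K)$: $\|\varphi\|(\gamma)=\bigwedge_{\alpha\in\gamma}\|\varphi\|(\alpha)$, $\|\neg\zeta\|(\gamma)=\overline{\|\zeta\|(\gamma)}$, $\|\zeta_1\oplus\zeta_2\|(\gamma)=\|\zeta_1\|(\gamma)\vee\|\zeta_2\|(\gamma)$,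 $\|\zeta_1\uplus\zeta_2\|(\gamma)=\bigvee_{\gamma_1,\gamma_2\in fC(P,K),\,\gamma_1\cup\gamma_2=\gamma}(\|\zeta_1\|(\gamma_1)\wedge\|\zeta_2\|(\gamma_2))$. Indexed operators denote iterated binary operators. $\zeta_1\equiv\zeta_2$ means $\|\zeta_1\|(\gamma)=\|\zeta_2\|(\gamma)$ for all $\gamma\in fC(P,K)$, for an arbitrary De Morgan algebra $K$. -}

module Defs where

open import Level using (Level; _⊔_) renaming (suc to lsuc)
open import Data.Bool using (Bool; true; false; _∧_; _∨_; not; if_then_else_)
open import Data.Nat using (ℕ; zero; suc)
open import Data.Fin using (Fin; zero; suc)
open import Data.Vec using (Vec; []; _∷_)
open import Data.List using (List; []; _∷_; _++_; map; concatMap; foldr)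
open import Data.Product using (Σ; _×_; _,_)
open import Relation.Binary.PropositionalEquality using (_≡_)
open import Relation.Nullary using (¬_)
open import Algebra.Core using (Op₁; Op₂)
import Algebra.Definitions as AD
import Algebra.Lattice.Structures as LS

record DeMorganAlgebra (c : Level) : Set (lsuc c) where
  infixr 6 _⊔ₖ_
  infixr 7 _⊓ₖ_
  field
    Carrier  : Set c
    _⊔ₖ_     : Op₂ Carrier
    _⊓ₖ_     : Op₂ Carrier
    𝟘        : Carrier
    𝟙        : Carrier
    compl    : Op₁ Carrier
    isDistributiveLattice : LS.IsDistributiveLattice {A = Carrier} _≡_ _⊔ₖ_ _⊓ₖ_
    ⊔-identity : AD.Identity {A = Carrier} _≡_ 𝟘 _⊔ₖ_
    ⊓-identity : AD.Identity {A = Carrier} _≡_ 𝟙 _⊓ₖ_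
    compl-involutive : AD.Involutive {A = Carrier} _≡_ compl
    deMorgan-⊔ : ∀ x y → compl (x ⊔ₖ y) ≡ compl x ⊓ₖ compl y
    deMorgan-⊓ : ∀ x y → compl (x ⊓ₖ y) ≡ compl x ⊔ₖ compl y

module _ {p c : Level} (P : Set p) (K : DeMorganAlgebra c) where
  open DeMorganAlgebra K

  FInteraction : Set (p ⊔ c)
  FInteraction = Σ (P → Carrier) λ α → Σ P λ q → ¬ (α q ≡ 𝟘)

  data FPIL : Set p where
    tt   : FPIL
    port : P → FPIL
    !_   : FPIL → FPIL
    _⊔ᶠ_ : FPIL → FPIL → FPIL

  ⟦_⟧ᴵ : FPIL → FInteraction → Carrier
  ⟦ tt ⟧ᴵ α = 𝟙
  ⟦ port q ⟧ᴵ (α , _) = α q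
  ⟦ ! φ ⟧ᴵ α = compl (⟦ φ ⟧ᴵ α)
  ⟦ φ₁ ⊔ᶠ φ₂ ⟧ᴵ α = ⟦ φ₁ ⟧ᴵ α ⊔ₖ ⟦ φ₂ ⟧ᴵ α

  infixr 5 _⊕_ _⊎ᶜ_
  data FPCL : Set p where
    pil   : FPIL → FPCL
    ¬ᶜ_   : FPCL → FPCL
    _⊕_   : FPCL → FPCL → FPCL
    _⊎ᶜ_  : FPCL → FPCL → FPCL

  _⊗_ : FPCL → FPCL → FPCL
  ζ ⊗ ζ' = ¬ᶜ ((¬ᶜ ζ) ⊕ (¬ᶜ ζ'))

  ∼_ : FPCL → FPCL
  ∼ ζ = ζ ⊎ᶜ pil tt

  -- A nonempty finite set γ ∈ fC(P,K) is
  -- presented as the image of an enumeration  e : Fin n → FInteraction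
  -- (with n ≥ 1); its sub-sets are described by subsets S : Vec Bool n
  -- of the index set (the sub-set being { e i | i ∈ S }).

  Sub : ℕ → Set
  Sub n = Vec Bool n

  nonempty? : ∀ {n} → Sub n → Bool
  nonempty? [] = false
  nonempty? (b ∷ S) = b ∨ nonempty? S

  _∪ˢ_ : ∀ {n} → Sub n → Sub n → Sub n
  [] ∪ˢ [] = []
  (a ∷ S) ∪ˢ (b ∷ T) = (a ∨ b) ∷ (S ∪ˢ T)

  _==ˢ_ : ∀ {n} → Sub n → Sub n → Bool
  [] ==ˢ [] = true
  (a ∷ S) ==ˢ (b ∷ T) = (if a then b else not b) ∧ (S ==ˢ T)

  allSubs : ∀ n → List (Sub n)
  allSubs zero = [] ∷ []
  allSubs (suc n) = map (false ∷_) (allSubs n) ++ map (true ∷_) (allSubs n)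

  meetOver : ∀ {n} → Sub n → (Fin n → Carrier) → Carrier
  meetOver [] f = 𝟙
  meetOver (b ∷ S) f = (if b then f zero else 𝟙) ⊓ₖ meetOver S (λ i → f (suc i))

  ⋁ : List Carrier → Carrier
  ⋁ = foldr _⊔ₖ_ 𝟘

  -- ‖ζ‖ evaluated at the sub-set { e i | i ∈ S }  (S assumed nonempty)
  ⟦_⟧ᶜ : FPCL → ∀ {n} → (Fin n → FInteraction) → Sub n → Carrier
  ⟦ pil φ ⟧ᶜ e S = meetOver S (λ i → ⟦ φ ⟧ᴵ (e i))
  ⟦ ¬ᶜ ζ ⟧ᶜ e S = compl (⟦ ζ ⟧ᶜ e S)
  ⟦ ζ₁ ⊕ ζ₂ ⟧ᶜ e S = ⟦ ζ₁ ⟧ᶜ e S ⊔ₖ ⟦ ζ₂ ⟧ᶜ e S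
  ⟦ ζ₁ ⊎ᶜ ζ₂ ⟧ᶜ {n} e S =
    ⋁ (concatMap (λ S₁ → map (λ S₂ →
         if nonempty? S₁ ∧ nonempty? S₂ ∧ ((S₁ ∪ˢ S₂) ==ˢ S)
         then ⟦ ζ₁ ⟧ᶜ e S₁ ⊓ₖ ⟦ ζ₂ ⟧ᶜ e S₂
         else 𝟘) (allSubs n)) (allSubs n))

  fullSub : ∀ n → Sub n
  fullSub zero = []
  fullSub (suc n) = true ∷ fullSub n

  ⟦_⟧ : FPCL → ∀ {n} → (Fin (suc n) → FInteraction) → Carrier
  ⟦ ζ ⟧ {n} e = ⟦ ζ ⟧ᶜ e (fullSub (suc n))

  _≃ᶜ_ : FPCL → FPCL → Set (p ⊔ c)
  ζ₁ ≃ᶜ ζ₂ = ∀ {n} (e : Fin (suc n) → FInteraction) → ⟦ ζ₁ ⟧ e ≡ ⟦ ζ₂ ⟧ e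

  iter : (FPCL → FPCL → FPCL) → ∀ {m} → (Fin (suc m) → FPCL) → FPCL
  iter op {zero} f = f zero
  iter op {suc m} f = op (f zero) (iter op (λ j → f (suc j)))

  ⨂ : ∀ {m} → (Fin (suc m) → FPCL) → FPCL
  ⨂ = iter _⊗_

  ⨄ : ∀ {m} → (Fin (suc m) → FPCL) → FPCL
  ⨄ = iter _⊎ᶜ_

-- On a finite set γ, ‖∼ ζ‖(γ) is the join of ‖ζ‖ over all nonempty sub-sets of γ: the
-- part covered by true can always be taken to be γ itself.  Such joins turn ⊎ into ⊓,
-- because by distributivity (⋁ ‖ζ₁‖) ⊓ (⋁ ‖ζ₂‖) is the join of ‖ζ₁‖(γ₁) ⊓ ‖ζ₂‖(γ₂) over
-- pairs of sub-sets, and each such pair covers γ₁ ∪ γ₂.  As ⊗ is interpreted by ⊓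
-- (De Morgan), induction over J gives the identity, for arbitrary fPCL formulas φⱼ.
module Submission where

open import Defs
open import Level using (Level)
open import Data.Bool using (Bool; true; false; _∧_; if_then_else_)
open import Data.Bool.Properties using (∨-zeroʳ; if-eta; if-cong)
open import Data.Nat using (ℕ; zero; suc)
open import Data.Fin using (Fin; zero; suc)
open import Data.Vec using ([]; _∷_)
open import Data.List using (List; []; _∷_; _++_; map; concatMap; foldr; cartesianProductWith)
open import Data.List.Relation.Unary.Any using (here; there)
open import Data.List.Membership.Propositional using (_∈_)
open import Data.List.Membership.Propositional.Properties
  using (∈-map⁺; ∈-map⁻; ∈-++⁺ˡ; ∈-++⁺ʳ; ∈-cartesianProductWith⁺; ∈-cartesianProductWith⁻)
open import Data.Product using (_,_; proj₁; proj₂)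
open import Relation.Binary.PropositionalEquality using (_≡_; refl; sym; trans; cong; cong₂; subst; subst₂; module ≡-Reasoning)
open import Algebra.Lattice.Bundles using (Lattice)
open import Algebra.Lattice.Structures using (IsDistributiveLattice)
import Algebra.Lattice.Properties.Lattice as LatticeProperties
import Relation.Binary.Lattice as OrderTheoretic
import Relation.Binary.Lattice.Properties.MeetSemilattice as MeetSemilatticeProperties

concatMap-map≡cartesianProductWith : ∀ {a b c} {A : Set a} {B : Set b} {C : Set c}
  (f : A → B → C) (xs : List A) (ys : List B) →
  concatMap (λ x → map (f x) ys) xs ≡ cartesianProductWith f xs ys
concatMap-map≡cartesianProductWith f []       ys = refl
concatMap-map≡cartesianProductWith f (x ∷ xs) ys =
  cong (map (f x) ys ++_) (concatMap-map≡cartesianProductWith f xs ys)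

module DeMorganOrder {c : Level} (K : DeMorganAlgebra c) where
  open DeMorganAlgebra K
  open IsDistributiveLattice isDistributiveLattice using (isLattice; ∧-distribˡ-∨; ∧-comm)

  lattice : Lattice c c
  lattice = record { isLattice = isLattice }

  open OrderTheoretic.Lattice (LatticeProperties.∨-∧-orderTheoreticLattice lattice) public
    using (_≤_; x≤x∨y; y≤x∨y; ∨-least; x∧y≤x; x∧y≤y; ∧-greatest; meetSemilattice)
    renaming (refl to ≤-refl; trans to ≤-trans; antisym to ≤-antisym)
  open MeetSemilatticeProperties meetSemilattice public using (∧-monotonic)

  𝟘≤ : ∀ x → 𝟘 ≤ x
  𝟘≤ x = subst (𝟘 ≤_) (proj₁ ⊔-identity x) (x≤x∨y 𝟘 x)

  ≤𝟙 : ∀ x → x ≤ 𝟙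
  ≤𝟙 x = sym (proj₂ ⊓-identity x)

  if-then-else-𝟘-≤ : ∀ b {x} → (if b then x else 𝟘) ≤ x
  if-then-else-𝟘-≤ true  = ≤-refl
  if-then-else-𝟘-≤ false = 𝟘≤ _

  ≤-⋁ : ∀ {x xs} → x ∈ xs → x ≤ foldr _⊔ₖ_ 𝟘 xs
  ≤-⋁ (here refl) = x≤x∨y _ _
  ≤-⋁ (there x∈xs) = ≤-trans (≤-⋁ x∈xs) (y≤x∨y _ _)

  ⋁-least : ∀ {y} xs → (∀ {x} → x ∈ xs → x ≤ y) → foldr _⊔ₖ_ 𝟘 xs ≤ y
  ⋁-least []       bound = 𝟘≤ _
  ⋁-least (x ∷ xs) bound = ∨-least (bound (here refl)) (⋁-least xs (λ x∈xs → bound (there x∈xs)))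

  ⊓-⋁-least : ∀ {x y} xs → (∀ {z} → z ∈ xs → x ⊓ₖ z ≤ y) → x ⊓ₖ foldr _⊔ₖ_ 𝟘 xs ≤ y
  ⊓-⋁-least {x} []       bound = ≤-trans (x∧y≤y x 𝟘) (𝟘≤ _)
  ⊓-⋁-least {x} (z ∷ xs) bound = subst (_≤ _) (sym (∧-distribˡ-∨ x z _))
    (∨-least (bound (here refl)) (⊓-⋁-least xs (λ z∈xs → bound (there z∈xs))))

  ⋁-⊓-⋁-least : ∀ {y} xs zs → (∀ {x z} → x ∈ xs → z ∈ zs → x ⊓ₖ z ≤ y) →
    foldr _⊔ₖ_ 𝟘 xs ⊓ₖ foldr _⊔ₖ_ 𝟘 zs ≤ y
  ⋁-⊓-⋁-least xs zs bound = ⊓-⋁-least zs λ z∈zs →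
    subst (_≤ _) (∧-comm _ _) (⊓-⋁-least xs λ x∈xs → subst (_≤ _) (∧-comm _ _) (bound x∈xs z∈zs))

module Semantics {p c : Level} (P : Set p) (K : DeMorganAlgebra c) where
  open DeMorganAlgebra K
  open DeMorganOrder K

  private
    nonempty : ∀ {n} → Sub P K n → Bool
    nonempty = nonempty? P K

    _∪_ : ∀ {n} → Sub P K n → Sub P K n → Sub P K n
    _∪_ = _∪ˢ_ P K

    full : ∀ n → Sub P K n
    full = fullSub P K

    subsets : ∀ n → List (Sub P K n)
    subsets = allSubs P K

  ∈-allSubs : ∀ {n} (S : Sub P K n) → S ∈ subsets n
  ∈-allSubs [] = here refl
  ∈-allSubs {suc n} (false ∷ S) = ∈-++⁺ˡ (∈-map⁺ (false ∷_) (∈-allSubs S))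
  ∈-allSubs {suc n} (true ∷ S) = ∈-++⁺ʳ (map (false ∷_) (subsets n)) (∈-map⁺ (true ∷_) (∈-allSubs S))

  ==ˢ-refl : ∀ {n} (S : Sub P K n) → _==ˢ_ P K S S ≡ true
  ==ˢ-refl [] = refl
  ==ˢ-refl (false ∷ S) = ==ˢ-refl S
  ==ˢ-refl (true ∷ S) = ==ˢ-refl S

  ∪ˢ-zeroʳ : ∀ {n} (S : Sub P K n) → S ∪ full n ≡ full n
  ∪ˢ-zeroʳ [] = refl
  ∪ˢ-zeroʳ (b ∷ S) = cong₂ _∷_ (∨-zeroʳ b) (∪ˢ-zeroʳ S)

  nonempty?-∪ˢ : ∀ {n} (S T : Sub P K n) → nonempty S ≡ true → nonempty (S ∪ T) ≡ true
  nonempty?-∪ˢ (true ∷ S) (b ∷ T) _ = refl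
  nonempty?-∪ˢ (false ∷ S) (true ∷ T) _ = refl
  nonempty?-∪ˢ (false ∷ S) (false ∷ T) S≢∅ = nonempty?-∪ˢ S T S≢∅

  nonempty?-fullSub : ∀ {n} (S : Sub P K n) → nonempty S ≡ true → nonempty (full n) ≡ true
  nonempty?-fullSub (_ ∷ _) _ = refl

  meetOver-𝟙 : ∀ {n} (S : Sub P K n) → meetOver P K S (λ _ → 𝟙) ≡ 𝟙
  meetOver-𝟙 [] = refl
  meetOver-𝟙 (b ∷ S) = trans (cong₂ _⊓ₖ_ (if-eta b) (meetOver-𝟙 S)) (proj₁ ⊓-identity 𝟙)

  module Enumeration {n : ℕ} (e : Fin n → FInteraction P K) where

    ‖_‖_ : FPCL P K → Sub P K n → Carrier
    ‖ ζ ‖ S = ⟦_⟧ᶜ P K ζ e S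

    -- The empty sub-set is not in fC(P,K); it contributes 𝟘 to joins.
    ‖_‖⁺_ : FPCL P K → Sub P K n → Carrier
    ‖ ζ ‖⁺ S = if nonempty S then ‖ ζ ‖ S else 𝟘

    ⋁‖_‖ : FPCL P K → Carrier
    ⋁‖ ζ ‖ = foldr _⊔ₖ_ 𝟘 (map (‖ ζ ‖⁺_) (subsets n))

    coverTerm : FPCL P K → FPCL P K → Sub P K n → Sub P K n → Sub P K n → Carrier
    coverTerm ζ₁ ζ₂ S S₁ S₂ =
      if nonempty S₁ ∧ nonempty S₂ ∧ _==ˢ_ P K (S₁ ∪ S₂) S then ‖ ζ₁ ‖ S₁ ⊓ₖ ‖ ζ₂ ‖ S₂ else 𝟘

    ‖⊎ᶜ‖≡⋁-coverTerm : ∀ ζ₁ ζ₂ S →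
      ‖ ζ₁ ⊎ᶜ ζ₂ ‖ S ≡ foldr _⊔ₖ_ 𝟘 (cartesianProductWith (coverTerm ζ₁ ζ₂ S) (subsets n) (subsets n))
    ‖⊎ᶜ‖≡⋁-coverTerm ζ₁ ζ₂ S =
      cong (foldr _⊔ₖ_ 𝟘) (concatMap-map≡cartesianProductWith (coverTerm ζ₁ ζ₂ S) (subsets n) (subsets n))

    ‖‖⁺≤⋁‖‖ : ∀ ζ S → ‖ ζ ‖⁺ S ≤ ⋁‖ ζ ‖
    ‖‖⁺≤⋁‖‖ ζ S = ≤-⋁ (∈-map⁺ (‖ ζ ‖⁺_) (∈-allSubs S))

    ‖‖≤⋁‖‖ : ∀ ζ {S} → nonempty S ≡ true → ‖ ζ ‖ S ≤ ⋁‖ ζ ‖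
    ‖‖≤⋁‖‖ ζ {S} S≢∅ = subst (_≤ ⋁‖ ζ ‖) (if-cong S≢∅) (‖‖⁺≤⋁‖‖ ζ S)

    coverTerm≤ : ∀ ζ₁ ζ₂ S S₁ S₂ → coverTerm ζ₁ ζ₂ S S₁ S₂ ≤ ‖ ζ₁ ‖⁺ S₁ ⊓ₖ ‖ ζ₂ ‖⁺ S₂
    coverTerm≤ ζ₁ ζ₂ S S₁ S₂ with nonempty S₁ | nonempty S₂
    ... | false | _     = 𝟘≤ _
    ... | true  | false = 𝟘≤ _
    ... | true  | true  = if-then-else-𝟘-≤ (_==ˢ_ P K (S₁ ∪ S₂) S)

    coverTerm-∪ˢ : ∀ ζ₁ ζ₂ {S₁ S₂} → nonempty S₁ ≡ true → nonempty S₂ ≡ true →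
      coverTerm ζ₁ ζ₂ (S₁ ∪ S₂) S₁ S₂ ≡ ‖ ζ₁ ‖ S₁ ⊓ₖ ‖ ζ₂ ‖ S₂
    coverTerm-∪ˢ ζ₁ ζ₂ {S₁} {S₂} S₁≢∅ S₂≢∅ =
      if-cong (trans (cong₂ (λ b₁ b₂ → b₁ ∧ b₂ ∧ _==ˢ_ P K (S₁ ∪ S₂) (S₁ ∪ S₂)) S₁≢∅ S₂≢∅)
                     (==ˢ-refl (S₁ ∪ S₂)))

    ‖⊎ᶜ‖≤ : ∀ ζ₁ ζ₂ S → ‖ ζ₁ ⊎ᶜ ζ₂ ‖ S ≤ ⋁‖ ζ₁ ‖ ⊓ₖ ⋁‖ ζ₂ ‖
    ‖⊎ᶜ‖≤ ζ₁ ζ₂ S = subst (_≤ _) (sym (‖⊎ᶜ‖≡⋁-coverTerm ζ₁ ζ₂ S)) (⋁-least _ bound)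
      where
      bound : ∀ {x} → x ∈ cartesianProductWith (coverTerm ζ₁ ζ₂ S) (subsets n) (subsets n) →
              x ≤ ⋁‖ ζ₁ ‖ ⊓ₖ ⋁‖ ζ₂ ‖
      bound x∈ with S₁ , S₂ , _ , _ , refl ← ∈-cartesianProductWith⁻ (coverTerm ζ₁ ζ₂ S) (subsets n) (subsets n) x∈ =
        ≤-trans (coverTerm≤ ζ₁ ζ₂ S S₁ S₂) (∧-monotonic (‖‖⁺≤⋁‖‖ ζ₁ S₁) (‖‖⁺≤⋁‖‖ ζ₂ S₂))

    ≤‖⊎ᶜ‖ : ∀ ζ₁ ζ₂ {S₁ S₂} → nonempty S₁ ≡ true → nonempty S₂ ≡ true →
      ‖ ζ₁ ‖ S₁ ⊓ₖ ‖ ζ₂ ‖ S₂ ≤ ‖ ζ₁ ⊎ᶜ ζ₂ ‖ (S₁ ∪ S₂)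
    ≤‖⊎ᶜ‖ ζ₁ ζ₂ {S₁} {S₂} S₁≢∅ S₂≢∅ =
      subst₂ _≤_ (coverTerm-∪ˢ ζ₁ ζ₂ S₁≢∅ S₂≢∅) (sym (‖⊎ᶜ‖≡⋁-coverTerm ζ₁ ζ₂ (S₁ ∪ S₂)))
        (≤-⋁ (∈-cartesianProductWith⁺ (coverTerm ζ₁ ζ₂ (S₁ ∪ S₂)) (∈-allSubs S₁) (∈-allSubs S₂)))

    ‖‖⁺⊓‖‖⁺≤⋁‖⊎ᶜ‖ : ∀ ζ₁ ζ₂ S₁ S₂ → ‖ ζ₁ ‖⁺ S₁ ⊓ₖ ‖ ζ₂ ‖⁺ S₂ ≤ ⋁‖ ζ₁ ⊎ᶜ ζ₂ ‖
    ‖‖⁺⊓‖‖⁺≤⋁‖⊎ᶜ‖ ζ₁ ζ₂ S₁ S₂ with nonempty S₁ in S₁≢∅ | nonempty S₂ in S₂≢∅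
    ... | false | _     = ≤-trans (x∧y≤x _ _) (𝟘≤ _)
    ... | true  | false = ≤-trans (x∧y≤y _ _) (𝟘≤ _)
    ... | true  | true  =
      ≤-trans (≤‖⊎ᶜ‖ ζ₁ ζ₂ S₁≢∅ S₂≢∅) (‖‖≤⋁‖‖ (ζ₁ ⊎ᶜ ζ₂) (nonempty?-∪ˢ S₁ S₂ S₁≢∅))

    ⋁‖⊎ᶜ‖ : ∀ ζ₁ ζ₂ → ⋁‖ ζ₁ ⊎ᶜ ζ₂ ‖ ≡ ⋁‖ ζ₁ ‖ ⊓ₖ ⋁‖ ζ₂ ‖
    ⋁‖⊎ᶜ‖ ζ₁ ζ₂ = ≤-antisym (⋁-least _ upper) (⋁-⊓-⋁-least _ _ lower)
      where
      upper : ∀ {x} → x ∈ map (‖ ζ₁ ⊎ᶜ ζ₂ ‖⁺_) (subsets n) → x ≤ ⋁‖ ζ₁ ‖ ⊓ₖ ⋁‖ ζ₂ ‖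
      upper x∈ with S , _ , refl ← ∈-map⁻ (‖ ζ₁ ⊎ᶜ ζ₂ ‖⁺_) x∈ =
        ≤-trans (if-then-else-𝟘-≤ (nonempty S)) (‖⊎ᶜ‖≤ ζ₁ ζ₂ S)
      lower : ∀ {x y} → x ∈ map (‖ ζ₁ ‖⁺_) (subsets n) → y ∈ map (‖ ζ₂ ‖⁺_) (subsets n) →
              x ⊓ₖ y ≤ ⋁‖ ζ₁ ⊎ᶜ ζ₂ ‖
      lower x∈ y∈ with S₁ , _ , refl ← ∈-map⁻ (‖ ζ₁ ‖⁺_) x∈ | S₂ , _ , refl ← ∈-map⁻ (‖ ζ₂ ‖⁺_) y∈ =
        ‖‖⁺⊓‖‖⁺≤⋁‖⊎ᶜ‖ ζ₁ ζ₂ S₁ S₂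

    ‖‖⁺≤‖∼‖ : ∀ ζ S → ‖ ζ ‖⁺ S ≤ ‖ ∼_ P K ζ ‖ (full n)
    ‖‖⁺≤‖∼‖ ζ S with nonempty S in S≢∅
    ... | false = 𝟘≤ _
    ... | true  = ≤-trans (∧-greatest ≤-refl ≤‖true‖)
      (subst (λ T → ‖ ζ ‖ S ⊓ₖ ‖ pil tt ‖ (full n) ≤ ‖ ∼_ P K ζ ‖ T) (∪ˢ-zeroʳ S) (≤‖⊎ᶜ‖ ζ (pil tt) S≢∅ (nonempty?-fullSub S S≢∅)))
      where
      ≤‖true‖ : ‖ ζ ‖ S ≤ ‖ pil tt ‖ (full n)
      ≤‖true‖ = subst (‖ ζ ‖ S ≤_) (sym (meetOver-𝟙 (full n))) (≤𝟙 _)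

    ‖∼‖ : ∀ ζ → ‖ ∼_ P K ζ ‖ (full n) ≡ ⋁‖ ζ ‖
    ‖∼‖ ζ = ≤-antisym (≤-trans (‖⊎ᶜ‖≤ ζ (pil tt) (full n)) (x∧y≤x _ _)) (⋁-least _ lower)
      where
      lower : ∀ {x} → x ∈ map (‖ ζ ‖⁺_) (subsets n) → x ≤ ‖ ∼_ P K ζ ‖ (full n)
      lower x∈ with S , _ , refl ← ∈-map⁻ (‖ ζ ‖⁺_) x∈ = ‖‖⁺≤‖∼‖ ζ S

    ‖⊗‖ : ∀ ζ₁ ζ₂ S → ‖ _⊗_ P K ζ₁ ζ₂ ‖ S ≡ ‖ ζ₁ ‖ S ⊓ₖ ‖ ζ₂ ‖ S
    ‖⊗‖ ζ₁ ζ₂ S = 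
      trans (deMorgan-⊔ (compl (‖ ζ₁ ‖ S)) (compl (‖ ζ₂ ‖ S)))
            (cong₂ _⊓ₖ_ (compl-involutive (‖ ζ₁ ‖ S)) (compl-involutive (‖ ζ₂ ‖ S)))

    ‖⨂∼‖ : ∀ {m} (ζ : Fin (suc m) → FPCL P K) →
      ‖ ⨂ P K (λ j → ∼_ P K (ζ j)) ‖ (full n) ≡ ⋁‖ ⨄ P K ζ ‖
    ‖⨂∼‖ {zero} ζ = ‖∼‖ (ζ zero)
    ‖⨂∼‖ {suc m} ζ = begin
      ‖ _⊗_ P K (∼_ P K (ζ zero)) (⨂ P K (λ j → ∼_ P K (ζ (suc j)))) ‖ (full n)
        ≡⟨ ‖⊗‖ (∼_ P K (ζ zero)) (⨂ P K (λ j → ∼_ P K (ζ (suc j)))) (full n) ⟩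
      ‖ ∼_ P K (ζ zero) ‖ (full n) ⊓ₖ ‖ ⨂ P K (λ j → ∼_ P K (ζ (suc j))) ‖ (full n)
        ≡⟨ cong₂ _⊓ₖ_ (‖∼‖ (ζ zero)) (‖⨂∼‖ (λ j → ζ (suc j))) ⟩
      ⋁‖ ζ zero ‖ ⊓ₖ ⋁‖ ⨄ P K (λ j → ζ (suc j)) ‖
        ≡⟨ ⋁‖⊎ᶜ‖ (ζ zero) (⨄ P K (λ j → ζ (suc j))) ⟨
      ⋁‖ ⨄ P K ζ ‖ ∎
      where open ≡-Reasoning

  ⨂∼≃∼⨄ : ∀ {m} (ζ : Fin (suc m) → FPCL P K) →
    _≃ᶜ_ P K (⨂ P K (λ j → ∼_ P K (ζ j))) (∼_ P K (⨄ P K ζ))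
  ⨂∼≃∼⨄ ζ e = trans (‖⨂∼‖ ζ) (sym (‖∼‖ (⨄ P K ζ)))
    where open Enumeration e

mainTheorem17 : {p c : Level} (P : Set p) (K : DeMorganAlgebra c)
    (m : ℕ) (φ : Fin (suc m) → FPIL P K) →
    _≃ᶜ_ P K (⨂ P K (λ j → ∼_ P K (pil (φ j))))
             (∼_ P K (⨄ P K (λ j → pil (φ j))))
mainTheorem17 P K m φ = Semantics.⨂∼≃∼⨄ P K (λ j → pil (φ j))
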